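{- Let $\mathcal P$ be a non-orientably regular polyhedron of type $\{p,q\}$ with automorphism group $\Gamma(\mathcal P)=\langle\rho_0,\rho_1,\rho_2\rangle$, $\sigma_1=\rho_0\rho_1$, $\sigma_2=\rho_1\rho_2$. Then neither $\langle\sigma_1^2\rangle$ nor $\langle\sigma_2^2\rangle$ is a normal subgroup of $\Gamma(\mathcal P)$.
   Context: An (abstract) polyhedron is a partially ordered set whose elements have rank 0 (vertices), 1 (edges) or 2 (faces) such that: every flag (maximal chain) consists of one vertex, one edge and one face; each edge is incident with exactly two vertices and exactly two faces; the vertex–edge graph is connected; and for every vertex $F_0$ the poset $\{G:G>F_0\}$ is isomorphic to the vertex–edge incidence poset of a connected 2-regular graph. $\Phi^i$ is the flag differing from flag $\Phi$ only in its rank-$i$ element. Type $\{p,q\}$: faces have $p$ edges, vertices lie on $q$ edges. Regular: automorphism group $\Gamma$ transitive on flags; with base flag $\Phi$, $\Gamma=\langle\rho_0,\rho_1,\rho_2\rangle$ with $\rho_i:\Phi\mapsto\Phi^i$; $\Gamma^+=\langle\sigma_1,\sigma_2\rangle$; non-orientably regular means $\Gamma^+=\Gamma$. -}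

module Defs where

open import Level using (0ℓ)
open import Data.Nat using (ℕ)
open import Data.Fin using (Fin; zero; suc)
open import Data.Product using (Σ; ∃; _×_; _,_; proj₁)
open import Data.Sum using (_⊎_; inj₁; inj₂)
open import Data.Empty using (⊥)
open import Relation.Nullary using (¬_)
open import Relation.Binary.PropositionalEquality using (_≡_; _≢_)
open import Relation.Binary.Structures using (IsStrictPartialOrder)
open import Relation.Binary.Construct.Closure.ReflexiveTransitive using (Star)
open import Function.Bundles using (_↔_; Inverse)
import Function.Bundles
import Function.Properties.Inverse
import Data.Product
import Relation.Binary.PropositionalEquality
import Data.Fin

ExactlyTwo : {A : Set} → (A → Set) → Set
ExactlyTwo {A} P =
  Σ A λ a → Σ A λ b → a ≢ b × P a × P b × (∀ c → P c → c ≡ a ⊎ c ≡ b)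

HasCard : {A : Set} → (A → Set) → ℕ → Set
HasCard {A} P n = Fin n ↔ Σ A P

record Graph : Set₁ where
  field
    V   : Set
    E   : Set
    _inc_ : V → E → Set

  Adj : V → V → Set
  Adj v w = Σ E λ e → v inc e × w inc e

record IsConnected2Regular (G : Graph) : Set where
  open Graph G
  field
    edge-two-ends : ∀ e → ExactlyTwo (λ v → v inc e)
    two-regular   : ∀ v → ExactlyTwo (λ e → v inc e)
    connected     : ∀ v w → Star Adj v w

IncLt : (G : Graph) → Graph.V G ⊎ Graph.E G → Graph.V G ⊎ Graph.E G → Set
IncLt G (inj₁ v) (inj₂ e) = Graph._inc_ G v e
IncLt G (inj₁ v) (inj₁ w) = ⊥
IncLt G (inj₂ e) _        = ⊥

rk0 rk1 rk2 : Fin 3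
rk0 = zero
rk1 = suc zero
rk2 = suc (suc zero)

record Polyhedron : Set₁ where
  field
    X     : Set
    _<_   : X → X → Set
    isSPO : IsStrictPartialOrder _≡_ _<_
    rank  : X → Fin 3
    rank-mono : ∀ {x y} → x < y → Data.Fin._<_ (rank x) (rank y)

  Comparable : X → X → Set
  Comparable x y = x ≡ y ⊎ x < y ⊎ y < x

  IsChain : (X → Set) → Set
  IsChain C = ∀ x y → C x → C y → Comparable x y

  IsMaximalChain : (X → Set) → Set
  IsMaximalChain C = IsChain C × (∀ x → (∀ y → C y → Comparable x y) → C x)

  VAdj : X → X → Set
  VAdj u w = Σ X λ e → rank e ≡ rk1 × u < e × w < e

  Above : X → Set
  Above F₀ = Σ X λ G → F₀ < G

  field
    flag-axiom : ∀ (C : X → Set) → IsMaximalChain C →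
      Σ X λ v → Σ X λ e → Σ X λ f →
        C v × C e × C f × rank v ≡ rk0 × rank e ≡ rk1 × rank f ≡ rk2 ×
        (∀ x → C x → x ≡ v ⊎ x ≡ e ⊎ x ≡ f)
    edge-vertices : ∀ e → rank e ≡ rk1 → ExactlyTwo (λ v → rank v ≡ rk0 × v < e)
    edge-faces    : ∀ e → rank e ≡ rk1 → ExactlyTwo (λ f → rank f ≡ rk2 × e < f)
    connected : ∀ u w → rank u ≡ rk0 → rank w ≡ rk0 → Star VAdj u w
    vertex-figure : ∀ F₀ → rank F₀ ≡ rk0 →
      Σ Graph λ G → IsConnected2Regular G ×
        Σ (Above F₀ ↔ (Graph.V G ⊎ Graph.E G)) λ φ →
          ∀ a b → (proj₁ a < proj₁ b → IncLt G (Inverse.to φ a) (Inverse.to φ b))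
                × (IncLt G (Inverse.to φ a) (Inverse.to φ b) → proj₁ a < proj₁ b)

module _ (P : Polyhedron) where
  open Polyhedron P

  HasType : ℕ → ℕ → Set
  HasType p q =
    (∀ f → rank f ≡ rk2 → HasCard (λ e → rank e ≡ rk1 × e < f) p) ×
    (∀ v → rank v ≡ rk0 → HasCard (λ e → rank e ≡ rk1 × v < e) q)

  -- flags as triples v < e < f (by flag-axiom, exactly the maximal chains)
  record Flag : Set where
    constructor flag
    field
      fv fe ff : X
      fv<fe : fv < fe
      fe<ff : fe < ff

  record Aut : Set where
    field
      bij : X ↔ X
      order : ∀ x y → (x < y → Inverse.to bij x < Inverse.to bij y)
                    × (Inverse.to bij x < Inverse.to bij y → x < y)

    app : X → X
    app = Inverse.to bij

    appInv : X → X
    appInv = Inverse.from bij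

  open Aut public

  _≈_ : Aut → Aut → Set
  g ≈ h = ∀ x → app g x ≡ app h x

  _maps_to_ : Aut → Flag → Flag → Set
  g maps Φ to Ψ = app g (Flag.fv Φ) ≡ Flag.fv Ψ
                × app g (Flag.fe Φ) ≡ Flag.fe Ψ
                × app g (Flag.ff Φ) ≡ Flag.ff Ψ

  IsAdjacent : Fin 3 → Flag → Flag → Set
  IsAdjacent zero Φ Ψ =
    Flag.fv Ψ ≢ Flag.fv Φ × Flag.fe Ψ ≡ Flag.fe Φ × Flag.ff Ψ ≡ Flag.ff Φ
  IsAdjacent (suc zero) Φ Ψ =
    Flag.fv Ψ ≡ Flag.fv Φ × Flag.fe Ψ ≢ Flag.fe Φ × Flag.ff Ψ ≡ Flag.ff Φ
  IsAdjacent (suc (suc zero)) Φ Ψ =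
    Flag.fv Ψ ≡ Flag.fv Φ × Flag.fe Ψ ≡ Flag.fe Φ × Flag.ff Ψ ≢ Flag.ff Φ

  MapsToAdjacent : Fin 3 → Aut → Flag → Set
  MapsToAdjacent i ρ Φ = Σ Flag λ Ψ → IsAdjacent i Φ Ψ × (ρ maps Φ to Ψ)

  IsRegular : Set
  IsRegular = ∀ (Φ Ψ : Flag) → Σ Aut λ g → g maps Φ to Ψ

  idA : Aut
  idA = record { bij = Function.Bundles.mk↔ₛ′ (λ x → x) (λ x → x) (λ _ → Relation.Binary.PropositionalEquality.refl) (λ _ → Relation.Binary.PropositionalEquality.refl)
               ; order = λ x y → (λ p → p) , (λ p → p) }

  _∘A_ : Aut → Aut → Aut      -- (g ∘A h) x = g (h x)
  g ∘A h = record
    { bij = Function.Properties.Inverse.↔-trans (bij h) (bij g)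
    ; order = λ x y →
        (λ p → proj₁ (order g (app h x) (app h y)) (proj₁ (order h x y) p))
      , (λ p → Data.Product.proj₂ (order h x y) (Data.Product.proj₂ (order g (app h x) (app h y)) p)) }

  invA : Aut → Aut
  invA g = record
    { bij = Function.Properties.Inverse.↔-sym (bij g)
    ; order = λ x y →
        (λ p → Data.Product.proj₂ (order g (appInv g x) (appInv g y))
                 (Relation.Binary.PropositionalEquality.subst₂ _<_
                   (Relation.Binary.PropositionalEquality.sym (Inverse.strictlyInverseˡ (bij g) x))
                   (Relation.Binary.PropositionalEquality.sym (Inverse.strictlyInverseˡ (bij g) y)) p))
      , (λ p → Relation.Binary.PropositionalEquality.subst₂ _<_
                 (Inverse.strictlyInverseˡ (bij g) x) (Inverse.strictlyInverseˡ (bij g) y)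
                 (proj₁ (order g (appInv g x) (appInv g y)) p)) }

  data Word (k : ℕ) : Set where
    ε    : Word k
    _·_  : Fin k → Word k → Word k
    _⁻·_ : Fin k → Word k → Word k

  eval : {k : ℕ} → (Fin k → Aut) → Word k → Aut
  eval gs ε        = idA
  eval gs (i · w)  = gs i ∘A eval gs w
  eval gs (i ⁻· w) = invA (gs i) ∘A eval gs w

  InSubgroup : {k : ℕ} → (Fin k → Aut) → Aut → Set
  InSubgroup gs g = Σ (Word _) λ w → eval gs w ≈ g

  IsNormal : {k : ℕ} → (Fin k → Aut) → Set
  IsNormal gs = ∀ (g h : Aut) → InSubgroup gs h → InSubgroup gs ((g ∘A h) ∘A invA g)

  one : Aut → Fin 1 → Aut
  one a _ = a

  two : Aut → Aut → Fin 2 → Aut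
  two a b zero = a
  two a b (suc _) = b

  -- non-orientably regular: regular and Γ⁺ = ⟨σ₁, σ₂⟩ is all of Γ(P)
  IsNonOrientablyRegular : Aut → Aut → Set
  IsNonOrientablyRegular σ₁ σ₂ = IsRegular × (∀ g → InSubgroup (two σ₁ σ₂) g)

-- Write σ₁ = ρ₀ρ₁, σ₂ = ρ₁ρ₂, N = ⟨σ₁²⟩ and T = ⟨σ₂⟩.  Since ρ₀ and ρ₂ commute,
-- σ₁σ₂σ₁ = σ₂⁻¹; so if N were normal, TN ∪ σ₁TN would be closed under left
-- multiplication by σ₁^±1 and σ₂^±1, and would contain ρ₀ because Γ = ⟨σ₁, σ₂⟩.
-- Either way some element of T ⊆ ⟨ρ₁, ρ₂⟩ or of N ⊆ ⟨ρ₀, ρ₁⟩ lands in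
-- ⟨ρ₀, ρ₁⟩ ∩ ⟨ρ₁, ρ₂⟩ = {1, ρ₁}, which puts ρ₀ or ρ₁ into N, or ρ₁ into T.  Then
-- that involution commutes with σ₁ (resp. σ₂), which collapses ⟨σ₁⟩ (resp. ⟨σ₂⟩)
-- to order at most 2 and forces some ρᵢ to be trivial.  For σ₂² run the same
-- argument on the reversed triple (ρ₂, ρ₁, ρ₀).
--
-- The polyhedron enters only through these properties of (ρ₀, ρ₁, ρ₂), all of which
-- follow from the diamond condition: two automorphisms that agree on a flag agree on
-- its adjacent flags, every flag is the image of the base flag under a word in σ₁, σ₂,
-- and hence an automorphism is determined by the image of the base flag.

module Submission where

open import Level using (_⊔_; 0ℓ)
open import Algebra.Bundles using (Group)
open import Data.Nat using (ℕ; s≤s)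
open import Data.Fin using (Fin; zero; suc)
import Data.Fin as Fin
open import Data.Product using (Σ; ∃; ∃₂; _×_; _,_; proj₁; proj₂)
open import Data.Sum using (_⊎_; inj₁; inj₂; [_,_])
open import Data.Empty using (⊥; ⊥-elim)
open import Function.Base using (_∘′_)
open import Function.Bundles using (Inverse)
open import Relation.Nullary using (¬_)
open import Relation.Unary using (Pred; _⊆_; _≐_; _∪_)
open import Relation.Binary.Definitions using (_Respects_)

module Subgroups {c ℓ} (G : Group c ℓ) where
  open Group G
  open import Algebra.Properties.Group G
  open import Relation.Binary.Reasoning.Setoid setoid

  data Generated {I : Set} (gs : I → Carrier) : Pred Carrier (c ⊔ ℓ) where
    ε∈     : Generated gs ε
    gen∙   : ∀ i {g} → Generated gs g → Generated gs (gs i ∙ g)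
    gen⁻¹∙ : ∀ i {g} → Generated gs g → Generated gs (gs i ⁻¹ ∙ g)
    ∈-resp : ∀ {g h} → g ≈ h → Generated gs g → Generated gs h

  ⟪_⟫ : Carrier → Pred Carrier (c ⊔ ℓ)
  ⟪ x ⟫ = Generated (λ (_ : Fin 1) → x)

  pair : Carrier → Carrier → Fin 2 → Carrier
  pair x y zero    = x
  pair x y (suc _) = y

  ⟨_,_⟩ : Carrier → Carrier → Pred Carrier (c ⊔ ℓ)
  ⟨ x , y ⟩ = Generated (pair x y)

  module _ {I : Set} {gs : I → Carrier} where

    Generated-ind : ∀ {p} (Q : Pred Carrier p) → Q Respects _≈_ → Q ε →
                    (∀ i {g} → Q g → Q (gs i ∙ g)) → (∀ i {g} → Q g → Q (gs i ⁻¹ ∙ g)) →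
                    Generated gs ⊆ Q
    Generated-ind Q resp qε q∙ q⁻¹∙ = go
      where
      go : Generated gs ⊆ Q
      go ε∈            = qε
      go (gen∙ i g∈)   = q∙ i (go g∈)
      go (gen⁻¹∙ i g∈) = q⁻¹∙ i (go g∈)
      go (∈-resp e g∈) = resp e (go g∈)

    gen∈ : ∀ i → Generated gs (gs i)
    gen∈ i = ∈-resp (identityʳ (gs i)) (gen∙ i ε∈)

  record IsSubgroup {p} (H : Pred Carrier p) : Set (c ⊔ ℓ ⊔ p) where
    field
      resp      : H Respects _≈_
      ε-closed  : H ε
      ∙-closed  : ∀ {g h} → H g → H h → H (g ∙ h)
      ⁻¹-closed : ∀ {g} → H g → H (g ⁻¹)

  module _ {I : Set} {gs : I → Carrier} where

    Generated-minimal : ∀ {p} {H : Pred Carrier p} → IsSubgroup H → (∀ i → H (gs i)) →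
                        Generated gs ⊆ H
    Generated-minimal H-subgroup gs∈H =
      Generated-ind _ resp ε-closed (λ i → ∙-closed (gs∈H i)) (λ i → ∙-closed (⁻¹-closed (gs∈H i)))
      where open IsSubgroup H-subgroup

    Generated-∙ : ∀ {g h} → Generated gs g → Generated gs h → Generated gs (g ∙ h)
    Generated-∙ g∈ h∈ = Generated-ind (λ g → Generated gs (g ∙ _))
      (λ e → ∈-resp (∙-congʳ e))
      (∈-resp (sym (identityˡ _)) h∈)
      (λ i g∈ → ∈-resp (sym (assoc _ _ _)) (gen∙ i g∈))
      (λ i g∈ → ∈-resp (sym (assoc _ _ _)) (gen⁻¹∙ i g∈))
      g∈

    Generated-⁻¹ : ∀ {g} → Generated gs g → Generated gs (g ⁻¹)
    Generated-⁻¹ = Generated-ind (λ g → Generated gs (g ⁻¹))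
      (λ e → ∈-resp (⁻¹-cong e))
      (∈-resp (sym ε⁻¹≈ε) ε∈)
      (λ i g⁻¹∈ → ∈-resp (sym (⁻¹-anti-homo-∙ (gs i) _))
                    (Generated-∙ g⁻¹∈ (∈-resp (identityʳ _) (gen⁻¹∙ i ε∈))))
      (λ i g⁻¹∈ → ∈-resp (trans (∙-congˡ (sym (⁻¹-involutive (gs i))))
                                (sym (⁻¹-anti-homo-∙ (gs i ⁻¹) _)))
                    (Generated-∙ g⁻¹∈ (gen∈ i)))

    Generated-isSubgroup : IsSubgroup (Generated gs)
    Generated-isSubgroup = record
      { resp = ∈-resp ; ε-closed = ε∈ ; ∙-closed = Generated-∙ ; ⁻¹-closed = Generated-⁻¹ }

  Generated-mono : ∀ {I J : Set} {gs : I → Carrier} {hs : J → Carrier} →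
                   (∀ i → Generated hs (gs i)) → Generated gs ⊆ Generated hs
  Generated-mono = Generated-minimal Generated-isSubgroup

  Normal : ∀ {p} → Pred Carrier p → Set (c ⊔ p)
  Normal H = ∀ g {h} → H h → H (g ∙ h ∙ g ⁻¹)

  Normal-resp : ∀ {p q} {H : Pred Carrier p} {K : Pred Carrier q} → H ≐ K → Normal H → Normal K
  Normal-resp (H⊆K , K⊆H) H-normal g h∈K = H⊆K (H-normal g (K⊆H h∈K))

  ⟪⟫-⁻¹ : ∀ {x y} → y ≈ x ⁻¹ → ⟪ x ⟫ ≐ ⟪ y ⟫
  ⟪⟫-⁻¹ {x} {y} y≈x⁻¹ =
    Generated-mono (λ _ → ∈-resp y⁻¹≈x (Generated-⁻¹ (gen∈ zero))) ,
    Generated-mono (λ _ → ∈-resp (sym y≈x⁻¹) (Generated-⁻¹ (gen∈ zero)))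
    where
    y⁻¹≈x : y ⁻¹ ≈ x
    y⁻¹≈x = trans (⁻¹-cong y≈x⁻¹) (⁻¹-involutive x)

  Commute : Carrier → Carrier → Set ℓ
  Commute x y = x ∙ y ≈ y ∙ x

  centraliser-isSubgroup : ∀ x → IsSubgroup (Commute x)
  centraliser-isSubgroup x = record
    { resp      = λ g≈h xg≈gx → trans (∙-congˡ (sym g≈h)) (trans xg≈gx (∙-congʳ g≈h))
    ; ε-closed  = trans (identityʳ x) (sym (identityˡ x))
    ; ∙-closed  = ∙-closed
    ; ⁻¹-closed = ⁻¹-closed
    }
    where
    ∙-closed : ∀ {g h} → Commute x g → Commute x h → Commute x (g ∙ h)
    ∙-closed {g} {h} xg≈gx xh≈hx = begin
      x ∙ (g ∙ h)  ≈⟨ assoc x g h ⟨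
      x ∙ g ∙ h    ≈⟨ ∙-congʳ xg≈gx ⟩
      g ∙ x ∙ h    ≈⟨ assoc g x h ⟩
      g ∙ (x ∙ h)  ≈⟨ ∙-congˡ xh≈hx ⟩
      g ∙ (h ∙ x)  ≈⟨ assoc g h x ⟨
      g ∙ h ∙ x    ∎
    ⁻¹-closed : ∀ {g} → Commute x g → Commute x (g ⁻¹)
    ⁻¹-closed {g} xg≈gx = ∙-cancelˡ g _ _ (begin
      g ∙ (x ∙ g ⁻¹)    ≈⟨ assoc g x (g ⁻¹) ⟨
      g ∙ x ∙ g ⁻¹      ≈⟨ ∙-congʳ xg≈gx ⟨
      x ∙ g ∙ g ⁻¹      ≈⟨ assoc x g (g ⁻¹) ⟩
      x ∙ (g ∙ g ⁻¹)    ≈⟨ ∙-congˡ (inverseʳ g) ⟩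
      x ∙ ε             ≈⟨ identityʳ x ⟩
      x                 ≈⟨ identityˡ x ⟨
      ε ∙ x             ≈⟨ ∙-congʳ (inverseʳ g) ⟨
      g ∙ g ⁻¹ ∙ x      ≈⟨ assoc g (g ⁻¹) x ⟩
      g ∙ (g ⁻¹ ∙ x)    ∎)

  ⟪⟫-centralises : ∀ {x s} → Commute x s → ⟪ s ⟫ ⊆ Commute x
  ⟪⟫-centralises xs≈sx = Generated-minimal (centraliser-isSubgroup _) (λ _ → xs≈sx)

  involution⁻¹ : ∀ {x} → x ∙ x ≈ ε → x ⁻¹ ≈ x
  involution⁻¹ {x} xx≈ε = sym (inverseʳ-unique x x xx≈ε)

  ⟪⟫-involution : ∀ {x} → x ∙ x ≈ ε → ⟪ x ⟫ ⊆ λ g → g ≈ ε ⊎ g ≈ x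
  ⟪⟫-involution {x} xx≈ε = Generated-ind _ resp (inj₁ refl) (λ _ → step)
    (λ _ g∈ → resp (∙-congʳ (sym (involution⁻¹ xx≈ε))) (step g∈))
    where
    resp : (λ g → g ≈ ε ⊎ g ≈ x) Respects _≈_
    resp g≈h (inj₁ g≈ε) = inj₁ (trans (sym g≈h) g≈ε)
    resp g≈h (inj₂ g≈x) = inj₂ (trans (sym g≈h) g≈x)
    step : ∀ {g} → g ≈ ε ⊎ g ≈ x → x ∙ g ≈ ε ⊎ x ∙ g ≈ x
    step (inj₁ g≈ε) = inj₂ (trans (∙-congˡ g≈ε) (identityʳ x))
    step (inj₂ g≈x) = inj₁ (trans (∙-congˡ g≈x) xx≈ε)

  ⟪⟫-trivial : ∀ {x} → x ≈ ε → ⟪ x ⟫ ⊆ (_≈ ε)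
  ⟪⟫-trivial {x} x≈ε g∈ with ⟪⟫-involution (trans (∙-congˡ x≈ε) (trans (identityʳ x) x≈ε)) g∈
  ... | inj₁ g≈ε = g≈ε
  ... | inj₂ g≈x = trans g≈x x≈ε

module StringCGroups {c ℓ} (G : Group c ℓ) where
  open Group G
  open import Algebra.Properties.Group G
  open import Algebra.Properties.Monoid monoid using (cancelˡ; cancelᶜ)
  open import Relation.Binary.Reasoning.Setoid setoid
  open Subgroups G

  module _ {x y : Carrier} (xx≈ε : x ∙ x ≈ ε) (yy≈ε : y ∙ y ≈ ε) where

    involution-product⁻¹ : (x ∙ y) ⁻¹ ≈ y ∙ x
    involution-product⁻¹ =
      trans (⁻¹-anti-homo-∙ x y) (∙-cong (involution⁻¹ yy≈ε) (involution⁻¹ xx≈ε))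

    commuteˡ⇒square≈ε : Commute (x ∙ y) x → (x ∙ y) ∙ (x ∙ y) ≈ ε
    commuteˡ⇒square≈ε xyx≈xxy = begin
      (x ∙ y) ∙ (x ∙ y)  ≈⟨ assoc (x ∙ y) x y ⟨
      (x ∙ y) ∙ x ∙ y    ≈⟨ ∙-congʳ xyx≈xxy ⟩
      x ∙ (x ∙ y) ∙ y    ≈⟨ ∙-congʳ (assoc x x y) ⟨
      x ∙ x ∙ y ∙ y      ≈⟨ ∙-congʳ (∙-congʳ xx≈ε) ⟩
      ε ∙ y ∙ y          ≈⟨ ∙-congʳ (identityˡ y) ⟩
      y ∙ y              ≈⟨ yy≈ε ⟩
      ε                  ∎

    commuteʳ⇒square≈ε : Commute (x ∙ y) y → (x ∙ y) ∙ (x ∙ y) ≈ ε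
    commuteʳ⇒square≈ε xyy≈yxy = begin
      (x ∙ y) ∙ (x ∙ y)  ≈⟨ assoc x y (x ∙ y) ⟩
      x ∙ (y ∙ (x ∙ y))  ≈⟨ ∙-congˡ xyy≈yxy ⟨
      x ∙ ((x ∙ y) ∙ y)  ≈⟨ ∙-congˡ (assoc x y y) ⟩
      x ∙ (x ∙ (y ∙ y))  ≈⟨ ∙-congˡ (∙-congˡ yy≈ε) ⟩
      x ∙ (x ∙ ε)        ≈⟨ ∙-congˡ (identityʳ x) ⟩
      x ∙ x              ≈⟨ xx≈ε ⟩
      ε                  ∎

  ⟨,⟩-swap : ∀ {x y} → ⟨ x , y ⟩ ⊆ ⟨ y , x ⟩
  ⟨,⟩-swap = Generated-mono swapped
    where
    swapped : ∀ {x y} (i : Fin 2) → ⟨ y , x ⟩ (pair x y i)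
    swapped zero    = gen∈ (suc zero)
    swapped (suc _) = gen∈ zero

  record IsNonOrientableStringCGroup (r₀ r₁ r₂ : Carrier) : Set (c ⊔ ℓ) where
    field
      involutive₀  : r₀ ∙ r₀ ≈ ε
      involutive₁  : r₁ ∙ r₁ ≈ ε
      involutive₂  : r₂ ∙ r₂ ≈ ε
      nontrivial₀  : r₀ ≉ ε
      nontrivial₁  : r₁ ≉ ε
      nontrivial₂  : r₂ ≉ ε
      commute₀₂    : Commute r₀ r₂
      intersection : ∀ {g} → ⟨ r₀ , r₁ ⟩ g → ⟨ r₁ , r₂ ⟩ g → g ≈ ε ⊎ g ≈ r₁
      rotations-generate : ∀ g → ⟨ r₀ ∙ r₁ , r₁ ∙ r₂ ⟩ g

  reverse : ∀ {r₀ r₁ r₂} → IsNonOrientableStringCGroup r₀ r₁ r₂ → IsNonOrientableStringCGroup r₂ r₁ r₀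
  reverse {r₀} {r₁} {r₂} 𝒢 = record
    { involutive₀  = involutive₂
    ; involutive₁  = involutive₁
    ; involutive₂  = involutive₀
    ; nontrivial₀  = nontrivial₂
    ; nontrivial₁  = nontrivial₁
    ; nontrivial₂  = nontrivial₀
    ; commute₀₂    = sym commute₀₂
    ; intersection = λ g∈⟨r₂,r₁⟩ g∈⟨r₁,r₀⟩ → intersection (⟨,⟩-swap g∈⟨r₁,r₀⟩) (⟨,⟩-swap g∈⟨r₂,r₁⟩)
    ; rotations-generate = λ g → Generated-mono inverted (rotations-generate g)
    }
    where
    open IsNonOrientableStringCGroup 𝒢
    inverted : ∀ i → ⟨ r₂ ∙ r₁ , r₁ ∙ r₀ ⟩ (pair (r₀ ∙ r₁) (r₁ ∙ r₂) i)
    inverted zero    =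
      ∈-resp (involution-product⁻¹ involutive₁ involutive₀) (Generated-⁻¹ (gen∈ (suc zero)))
    inverted (suc _) =
      ∈-resp (involution-product⁻¹ involutive₂ involutive₁) (Generated-⁻¹ (gen∈ zero))

  module _ {r₀ r₁ r₂} (𝒢 : IsNonOrientableStringCGroup r₀ r₁ r₂) where
    open IsNonOrientableStringCGroup 𝒢

    private
      σ₁ σ₂ : Carrier
      σ₁ = r₀ ∙ r₁
      σ₂ = r₁ ∙ r₂
      N T : Pred Carrier (c ⊔ ℓ)
      N = ⟪ σ₁ ∙ σ₁ ⟫
      T = ⟪ σ₂ ⟫

    σ₁σ₂σ₁≈σ₂⁻¹ : σ₁ ∙ σ₂ ∙ σ₁ ≈ σ₂ ⁻¹
    σ₁σ₂σ₁≈σ₂⁻¹ = begin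
      σ₁ ∙ σ₂ ∙ σ₁         ≈⟨ ∙-congʳ (cancelᶜ involutive₁ r₀ r₂) ⟩
      r₀ ∙ r₂ ∙ (r₀ ∙ r₁)  ≈⟨ ∙-congʳ commute₀₂ ⟩
      r₂ ∙ r₀ ∙ (r₀ ∙ r₁)  ≈⟨ cancelᶜ involutive₀ r₂ r₁ ⟩
      r₂ ∙ r₁              ≈⟨ involution-product⁻¹ involutive₁ involutive₂ ⟨
      σ₂ ⁻¹                ∎

    σ₂σ₁≈σ₁⁻¹σ₂⁻¹ : σ₂ ∙ σ₁ ≈ σ₁ ⁻¹ ∙ σ₂ ⁻¹
    σ₂σ₁≈σ₁⁻¹σ₂⁻¹ = y≈x\\z σ₁ (σ₂ ∙ σ₁) (σ₂ ⁻¹) (trans (sym (assoc σ₁ σ₂ σ₁)) σ₁σ₂σ₁≈σ₂⁻¹)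

    N⊆⟨r₀,r₁⟩ : N ⊆ ⟨ r₀ , r₁ ⟩
    N⊆⟨r₀,r₁⟩ = Generated-mono λ _ → Generated-∙ σ₁∈ σ₁∈
      where
      σ₁∈ : ⟨ r₀ , r₁ ⟩ σ₁
      σ₁∈ = Generated-∙ (gen∈ zero) (gen∈ (suc zero))

    T⊆⟨r₁,r₂⟩ : T ⊆ ⟨ r₁ , r₂ ⟩
    T⊆⟨r₁,r₂⟩ = Generated-mono λ _ → Generated-∙ (gen∈ zero) (gen∈ (suc zero))

    r₁∉T : ¬ T r₁
    r₁∉T r₁∈ = excluded (⟪⟫-involution σ₂σ₂≈ε r₁∈)
      where
      σ₂σ₂≈ε : σ₂ ∙ σ₂ ≈ ε
      σ₂σ₂≈ε = commuteˡ⇒square≈ε involutive₁ involutive₂ (⟪⟫-centralises refl r₁∈)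
      excluded : r₁ ≈ ε ⊎ r₁ ≈ σ₂ → ⊥
      excluded (inj₁ r₁≈ε)  = nontrivial₁ r₁≈ε
      excluded (inj₂ r₁≈σ₂) = nontrivial₂ (sym (∙-cancelˡ r₁ ε r₂ (trans (identityʳ r₁) r₁≈σ₂)))

    N⊆centraliser : N ⊆ Commute σ₁
    N⊆centraliser = ⟪⟫-centralises (sym (assoc σ₁ σ₁ σ₁))

    r₀∉N : ¬ N r₀
    r₀∉N r₀∈ = nontrivial₀ (⟪⟫-trivial σ₁σ₁≈ε r₀∈)
      where
      σ₁σ₁≈ε : σ₁ ∙ σ₁ ≈ ε
      σ₁σ₁≈ε = commuteˡ⇒square≈ε involutive₀ involutive₁ (N⊆centraliser r₀∈)

    r₁∉N : ¬ N r₁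
    r₁∉N r₁∈ = nontrivial₁ (⟪⟫-trivial σ₁σ₁≈ε r₁∈)
      where
      σ₁σ₁≈ε : σ₁ ∙ σ₁ ≈ ε
      σ₁σ₁≈ε = commuteʳ⇒square≈ε involutive₀ involutive₁ (N⊆centraliser r₁∈)

    TN : Pred Carrier (c ⊔ ℓ)
    TN g = ∃₂ λ t n → T t × N n × g ≈ t ∙ n

    σ₁TN : Pred Carrier (c ⊔ ℓ)
    σ₁TN g = ∃ λ m → TN m × g ≈ σ₁ ∙ m

    r₀∉TN : ¬ TN r₀
    r₀∉TN (t , n , t∈T , n∈N , r₀≈tn) = excluded (intersection t∈⟨r₀,r₁⟩ (T⊆⟨r₁,r₂⟩ t∈T))
      where
      t∈⟨r₀,r₁⟩ : ⟨ r₀ , r₁ ⟩ t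
      t∈⟨r₀,r₁⟩ = ∈-resp (sym (x≈z//y t n r₀ (sym r₀≈tn)))
                    (Generated-∙ (gen∈ zero) (Generated-⁻¹ (N⊆⟨r₀,r₁⟩ n∈N)))
      excluded : t ≈ ε ⊎ t ≈ r₁ → ⊥
      excluded (inj₁ t≈ε)  =
        r₀∉N (∈-resp (sym (trans r₀≈tn (trans (∙-congʳ t≈ε) (identityˡ n)))) n∈N)
      excluded (inj₂ t≈r₁) = r₁∉T (∈-resp t≈r₁ t∈T)

    r₀∉σ₁TN : ¬ σ₁TN r₀
    r₀∉σ₁TN (m , (t , n , t∈T , n∈N , m≈tn) , r₀≈σ₁m) =
      excluded (intersection (N⊆⟨r₀,r₁⟩ n∈N) n∈⟨r₁,r₂⟩)
      where
      r₁m≈ε : r₁ ∙ m ≈ ε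
      r₁m≈ε = ∙-cancelˡ r₀ (r₁ ∙ m) ε
                (trans (sym (assoc r₀ r₁ m)) (trans (sym r₀≈σ₁m) (sym (identityʳ r₀))))
      tn≈r₁ : t ∙ n ≈ r₁
      tn≈r₁ = trans (sym m≈tn) (trans (inverseʳ-unique r₁ m r₁m≈ε) (involution⁻¹ involutive₁))
      n∈⟨r₁,r₂⟩ : ⟨ r₁ , r₂ ⟩ n
      n∈⟨r₁,r₂⟩ = ∈-resp (sym (y≈x\\z t n r₁ tn≈r₁))
                    (Generated-∙ (Generated-⁻¹ (T⊆⟨r₁,r₂⟩ t∈T)) (gen∈ zero))
      excluded : n ≈ ε ⊎ n ≈ r₁ → ⊥
      excluded (inj₁ n≈ε)  =
        r₁∉T (∈-resp (trans (sym (identityʳ t)) (trans (∙-congˡ (sym n≈ε)) tn≈r₁)) t∈T)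
      excluded (inj₂ n≈r₁) = r₁∉N (∈-resp n≈r₁ n∈N)

    module _ (N-normal : Normal N) where

      TN-resp : TN Respects _≈_
      TN-resp g≈h (t , n , t∈ , n∈ , g≈tn) = t , n , t∈ , n∈ , trans (sym g≈h) g≈tn

      TN-∙ : ∀ {x y} → TN x → TN y → TN (x ∙ y)
      TN-∙ {x} {y} (t , n , t∈ , n∈ , x≈tn) (t′ , n′ , t′∈ , n′∈ , y≈t′n′) =
        t ∙ t′ , t′ ⁻¹ ∙ n ∙ t′ ⁻¹ ⁻¹ ∙ n′ ,
        Generated-∙ t∈ t′∈ , Generated-∙ (N-normal (t′ ⁻¹) n∈) n′∈ , (begin
          x ∙ y                                  ≈⟨ ∙-cong x≈tn y≈t′n′ ⟩
          t ∙ n ∙ (t′ ∙ n′)                      ≈⟨ assoc t n (t′ ∙ n′) ⟩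
          t ∙ (n ∙ (t′ ∙ n′))                    ≈⟨ ∙-congˡ (assoc n t′ n′) ⟨
          t ∙ (n ∙ t′ ∙ n′)                      ≈⟨ cancelᶜ (inverseʳ t′) t (n ∙ t′ ∙ n′) ⟨
          t ∙ t′ ∙ (t′ ⁻¹ ∙ (n ∙ t′ ∙ n′))       ≈⟨ ∙-congˡ (assoc (t′ ⁻¹) (n ∙ t′) n′) ⟨
          t ∙ t′ ∙ (t′ ⁻¹ ∙ (n ∙ t′) ∙ n′)       ≈⟨ ∙-congˡ (∙-congʳ (assoc (t′ ⁻¹) n t′)) ⟨
          t ∙ t′ ∙ (t′ ⁻¹ ∙ n ∙ t′ ∙ n′)         ≈⟨ ∙-congˡ (∙-congʳ (∙-congˡ (⁻¹-involutive t′))) ⟨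
          t ∙ t′ ∙ (t′ ⁻¹ ∙ n ∙ t′ ⁻¹ ⁻¹ ∙ n′)   ∎)

      ε∈TN : TN ε
      ε∈TN = ε , ε , ε∈ , ε∈ , sym (identityˡ ε)

      T⊆TN : T ⊆ TN
      T⊆TN {t} t∈ = t , ε , t∈ , ε∈ , sym (identityʳ t)

      N⊆TN : N ⊆ TN
      N⊆TN {n} n∈ = ε , n , ε∈ , n∈ , sym (identityˡ n)

      Cosets : Pred Carrier (c ⊔ ℓ)
      Cosets = TN ∪ σ₁TN

      Cosets-resp : Cosets Respects _≈_
      Cosets-resp g≈h (inj₁ g∈) = inj₁ (TN-resp g≈h g∈)
      Cosets-resp g≈h (inj₂ (m , m∈ , g≈σ₁m)) = inj₂ (m , m∈ , trans (sym g≈h) g≈σ₁m)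

      coset-step : ∀ {x g} → Cosets x → Cosets (x ∙ σ₁) → Cosets g → Cosets (x ∙ g)
      coset-step (inj₁ x∈) _ (inj₁ g∈) = inj₁ (TN-∙ x∈ g∈)
      coset-step {x} {g} (inj₂ (m , m∈ , x≈σ₁m)) _ (inj₁ g∈) =
        inj₂ (m ∙ g , TN-∙ m∈ g∈ , trans (∙-congʳ x≈σ₁m) (assoc σ₁ m g))
      coset-step {x} {g} _ (inj₁ xσ₁∈) (inj₂ (m , m∈ , g≈σ₁m)) =
        inj₁ (TN-resp (trans (assoc x σ₁ m) (∙-congˡ (sym g≈σ₁m))) (TN-∙ xσ₁∈ m∈))
      coset-step {x} {g} _ (inj₂ (m′ , m′∈ , xσ₁≈σ₁m′)) (inj₂ (m , m∈ , g≈σ₁m)) =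
        inj₂ (m′ ∙ m , TN-∙ m′∈ m∈ , (begin
          x ∙ g          ≈⟨ ∙-congˡ g≈σ₁m ⟩
          x ∙ (σ₁ ∙ m)   ≈⟨ assoc x σ₁ m ⟨
          x ∙ σ₁ ∙ m     ≈⟨ ∙-congʳ xσ₁≈σ₁m′ ⟩
          σ₁ ∙ m′ ∙ m    ≈⟨ assoc σ₁ m′ m ⟩
          σ₁ ∙ (m′ ∙ m)  ∎))

      σ₁[σ₁σ₁]⁻¹≈σ₁⁻¹ : σ₁ ∙ (σ₁ ∙ σ₁) ⁻¹ ≈ σ₁ ⁻¹
      σ₁[σ₁σ₁]⁻¹≈σ₁⁻¹ = trans (∙-congˡ (⁻¹-anti-homo-∙ σ₁ σ₁)) (cancelˡ (inverseʳ σ₁) (σ₁ ⁻¹))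

      σ₁-cosets : Cosets σ₁ × Cosets (σ₁ ∙ σ₁)
      σ₁-cosets = inj₂ (ε , ε∈TN , sym (identityʳ σ₁)) , inj₁ (N⊆TN (gen∈ zero))

      σ₁⁻¹-cosets : Cosets (σ₁ ⁻¹) × Cosets (σ₁ ⁻¹ ∙ σ₁)
      σ₁⁻¹-cosets = inj₂ ((σ₁ ∙ σ₁) ⁻¹ , N⊆TN (Generated-⁻¹ (gen∈ zero)) , sym σ₁[σ₁σ₁]⁻¹≈σ₁⁻¹)
                  , inj₁ (TN-resp (sym (inverseˡ σ₁)) ε∈TN)

      σ₂-cosets : Cosets σ₂ × Cosets (σ₂ ∙ σ₁)
      σ₂-cosets = inj₁ (T⊆TN (gen∈ zero))
                , inj₂ ((σ₁ ∙ σ₁) ⁻¹ ∙ σ₂ ⁻¹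
                       , TN-∙ (N⊆TN (Generated-⁻¹ (gen∈ zero))) (T⊆TN (Generated-⁻¹ (gen∈ zero)))
                       , (begin
                           σ₂ ∙ σ₁                       ≈⟨ σ₂σ₁≈σ₁⁻¹σ₂⁻¹ ⟩
                           σ₁ ⁻¹ ∙ σ₂ ⁻¹                 ≈⟨ ∙-congʳ σ₁[σ₁σ₁]⁻¹≈σ₁⁻¹ ⟨
                           σ₁ ∙ (σ₁ ∙ σ₁) ⁻¹ ∙ σ₂ ⁻¹     ≈⟨ assoc σ₁ ((σ₁ ∙ σ₁) ⁻¹) (σ₂ ⁻¹) ⟩
                           σ₁ ∙ ((σ₁ ∙ σ₁) ⁻¹ ∙ σ₂ ⁻¹)   ∎))

      σ₂⁻¹-cosets : Cosets (σ₂ ⁻¹) × Cosets (σ₂ ⁻¹ ∙ σ₁)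
      σ₂⁻¹-cosets = inj₁ (T⊆TN (Generated-⁻¹ (gen∈ zero)))
                  , inj₂ (σ₂ ∙ (σ₁ ∙ σ₁) , (σ₂ , σ₁ ∙ σ₁ , gen∈ zero , gen∈ zero , refl) , (begin
                      σ₂ ⁻¹ ∙ σ₁              ≈⟨ ∙-congʳ σ₁σ₂σ₁≈σ₂⁻¹ ⟨
                      σ₁ ∙ σ₂ ∙ σ₁ ∙ σ₁       ≈⟨ assoc (σ₁ ∙ σ₂) σ₁ σ₁ ⟩
                      σ₁ ∙ σ₂ ∙ (σ₁ ∙ σ₁)     ≈⟨ assoc σ₁ σ₂ (σ₁ ∙ σ₁) ⟩
                      σ₁ ∙ (σ₂ ∙ (σ₁ ∙ σ₁))   ∎))

      cosets-cover : ∀ g → Cosets g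
      cosets-cover g = Generated-ind Cosets Cosets-resp (inj₁ ε∈TN) step step⁻¹ (rotations-generate g)
        where
        step : ∀ i {g} → Cosets g → Cosets (pair σ₁ σ₂ i ∙ g)
        step zero    = coset-step (proj₁ σ₁-cosets) (proj₂ σ₁-cosets)
        step (suc _) = coset-step (proj₁ σ₂-cosets) (proj₂ σ₂-cosets)
        step⁻¹ : ∀ i {g} → Cosets g → Cosets (pair σ₁ σ₂ i ⁻¹ ∙ g)
        step⁻¹ zero    = coset-step (proj₁ σ₁⁻¹-cosets) (proj₂ σ₁⁻¹-cosets)
        step⁻¹ (suc _) = coset-step (proj₁ σ₂⁻¹-cosets) (proj₂ σ₂⁻¹-cosets)

    σ₁²-not-normal : ¬ Normal N
    σ₁²-not-normal N-normal = [ r₀∉TN , r₀∉σ₁TN ] (cosets-cover N-normal r₀)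

  σ₂²-not-normal : ∀ {r₀ r₁ r₂} → IsNonOrientableStringCGroup r₀ r₁ r₂ →
                   ¬ Normal ⟪ (r₁ ∙ r₂) ∙ (r₁ ∙ r₂) ⟫
  σ₂²-not-normal {r₀} {r₁} {r₂} 𝒢 σ₂²-normal =
    σ₁²-not-normal (reverse 𝒢) (Normal-resp (⟪⟫-⁻¹ square-reversed) σ₂²-normal)
    where
    open IsNonOrientableStringCGroup 𝒢
    square-reversed : (r₂ ∙ r₁) ∙ (r₂ ∙ r₁) ≈ ((r₁ ∙ r₂) ∙ (r₁ ∙ r₂)) ⁻¹
    square-reversed = sym (trans (⁻¹-anti-homo-∙ (r₁ ∙ r₂) (r₁ ∙ r₂)) (∙-cong σ₂⁻¹≈r₂r₁ σ₂⁻¹≈r₂r₁))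
      where
      σ₂⁻¹≈r₂r₁ : (r₁ ∙ r₂) ⁻¹ ≈ r₂ ∙ r₁
      σ₂⁻¹≈r₂r₁ = involution-product⁻¹ involutive₁ involutive₂

open import Relation.Binary.PropositionalEquality
open import Relation.Binary.Structures using (IsStrictPartialOrder)
open import Defs

Fin3-chain : {i j k : Fin 3} → i Fin.< j → j Fin.< k → i ≡ rk0 × j ≡ rk1 × k ≡ rk2
Fin3-chain {zero} {suc zero} {suc (suc zero)} _ _ = refl , refl , refl
Fin3-chain {_} {suc zero} {suc zero} _ (s≤s ())
Fin3-chain {suc _} {suc zero} (s≤s ()) _
Fin3-chain {_} {suc (suc zero)} {suc (suc zero)} _ (s≤s (s≤s ()))
Fin3-chain {_} {suc (suc zero)} {suc zero} _ (s≤s ())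
Fin3-chain {_} {_} {zero} _ ()
Fin3-chain {_} {zero} () _

AtMostTwo : {A : Set} → (A → Set) → Set
AtMostTwo {A} Q = Σ A λ α → Σ A λ β → ∀ u → Q u → u ≡ α ⊎ u ≡ β

module _ {A : Set} {Q : A → Set} where

  ExactlyTwo⇒AtMostTwo : ExactlyTwo Q → AtMostTwo Q
  ExactlyTwo⇒AtMostTwo (α , β , _ , _ , _ , Q⊆αβ) = α , β , Q⊆αβ

  AtMostTwo-⊆ : {R : A → Set} → (∀ u → R u → Q u) → AtMostTwo Q → AtMostTwo R
  AtMostTwo-⊆ R⊆Q (α , β , Q⊆αβ) = α , β , λ u Ru → Q⊆αβ u (R⊆Q u Ru)

  AtMostTwo-map : {B : Set} {R : B → Set} (f : A → B) →
                  (∀ b → R b → Σ A λ a → Q a × f a ≡ b) → AtMostTwo Q → AtMostTwo R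
  AtMostTwo-map f R⊆fQ (α , β , Q⊆αβ) = f α , f β , λ b Rb → image (R⊆fQ b Rb)
    where
    image : ∀ {b} → Σ A (λ a → Q a × f a ≡ b) → b ≡ f α ⊎ b ≡ f β
    image (a , Qa , refl) with Q⊆αβ a Qa
    ... | inj₁ refl = inj₁ refl
    ... | inj₂ refl = inj₂ refl

  AtMostTwo-other : ∀ {p q x} → AtMostTwo Q → Q p → Q q → q ≢ p → Q x → x ≡ p ⊎ x ≡ q
  AtMostTwo-other {p} {q} {x} (α , β , Q⊆αβ) Qp Qq q≢p Qx = go (Q⊆αβ p Qp) (Q⊆αβ q Qq) (Q⊆αβ x Qx)
    where
    go : p ≡ α ⊎ p ≡ β → q ≡ α ⊎ q ≡ β → x ≡ α ⊎ x ≡ β → x ≡ p ⊎ x ≡ q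
    go (inj₁ refl) (inj₁ refl) _           = ⊥-elim (q≢p refl)
    go (inj₂ refl) (inj₂ refl) _           = ⊥-elim (q≢p refl)
    go (inj₁ refl) (inj₂ refl) (inj₁ refl) = inj₁ refl
    go (inj₁ refl) (inj₂ refl) (inj₂ refl) = inj₂ refl
    go (inj₂ refl) (inj₁ refl) (inj₁ refl) = inj₂ refl
    go (inj₂ refl) (inj₁ refl) (inj₂ refl) = inj₁ refl

  AtMostTwo-unique : ∀ {p x y} → AtMostTwo Q → Q p → Q x → Q y → x ≢ p → y ≢ p → x ≡ y
  AtMostTwo-unique two Qp Qx Qy x≢p y≢p with AtMostTwo-other two Qp Qx x≢p Qy
  ... | inj₁ y≡p = ⊥-elim (y≢p y≡p)
  ... | inj₂ y≡x = sym y≡x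

IncLt-AtMostTwo : (G : Graph) → (∀ e → ExactlyTwo (λ v → Graph._inc_ G v e)) →
                  ∀ t → AtMostTwo (λ s → IncLt G s t)
IncLt-AtMostTwo G _ t@(inj₁ _) = t , t , λ { (inj₁ _) () ; (inj₂ _) () }
IncLt-AtMostTwo G edge-two-ends (inj₂ e) with edge-two-ends e
... | a , b , _ , _ , _ , ends = inj₁ a , inj₁ b , below
  where
  below : ∀ s → IncLt G s (inj₂ e) → s ≡ inj₁ a ⊎ s ≡ inj₁ b
  below (inj₁ w) w-inc with ends w w-inc
  ... | inj₁ refl = inj₁ refl
  ... | inj₂ refl = inj₂ refl
  below (inj₂ _) ()

module Polyhedral (P : Polyhedron) where
  open Polyhedron P
  open Flag

  private
    variable
      x y z : X
      g h k : Aut P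
      Ψ Ψ′ Ψ₁ Ψ₂ : Flag P

  app-mono : ∀ (g : Aut P) → x < y → app g x < app g y
  app-mono g = proj₁ (order g _ _)

  app-inverseˡ : ∀ (g : Aut P) x → app (invA P g) (app g x) ≡ x
  app-inverseˡ g = Inverse.strictlyInverseʳ (bij g)

  app-inverseʳ : ∀ (g : Aut P) x → app g (app (invA P g) x) ≡ x
  app-inverseʳ g = Inverse.strictlyInverseˡ (bij g)

  app-injective : ∀ (g : Aut P) → app g x ≡ app g y → x ≡ y
  app-injective {x = x} {y = y} g gx≡gy =
    trans (sym (app-inverseˡ g x)) (trans (cong (app (invA P g)) gx≡gy) (app-inverseˡ g y))

  chain-ranks : x < y → y < z → rank x ≡ rk0 × rank y ≡ rk1 × rank z ≡ rk2
  chain-ranks x<y y<z = Fin3-chain (rank-mono x<y) (rank-mono y<z)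

  vertices-below : x < y → y < z → AtMostTwo (_< y)
  vertices-below {y = y} x<y y<z =
    AtMostTwo-⊆ (λ u u<y → proj₁ (chain-ranks u<y y<z) , u<y)
      (ExactlyTwo⇒AtMostTwo (edge-vertices y (proj₁ (proj₂ (chain-ranks x<y y<z)))))

  faces-above : x < y → y < z → AtMostTwo (y <_)
  faces-above {y = y} x<y y<z =
    AtMostTwo-⊆ (λ u y<u → proj₂ (proj₂ (chain-ranks x<y y<u)) , y<u)
      (ExactlyTwo⇒AtMostTwo (edge-faces y (proj₁ (proj₂ (chain-ranks x<y y<z)))))

  -- The edges between x and z are the vertices of the vertex figure at x that lie on
  -- the edge of that figure corresponding to z.
  edges-between : x < y → y < z → AtMostTwo (λ u → x < u × u < z)
  edges-between {x} {y} {z} x<y y<z with vertex-figure x (proj₁ (chain-ranks x<y y<z))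
  ... | G , G-regular , φ , φ-iso =
    AtMostTwo-map (λ s → proj₁ (Inverse.from φ s)) preimage
      (IncLt-AtMostTwo G (IsConnected2Regular.edge-two-ends G-regular) (Inverse.to φ (z , x<z)))
    where
    x<z : x < z
    x<z = IsStrictPartialOrder.trans isSPO x<y y<z
    preimage : ∀ u → x < u × u < z →
               Σ (Graph.V G ⊎ Graph.E G) λ s →
                 IncLt G s (Inverse.to φ (z , x<z)) × proj₁ (Inverse.from φ s) ≡ u
    preimage u (x<u , u<z) = Inverse.to φ (u , x<u) , proj₁ (φ-iso (u , x<u) (z , x<z)) u<z
                           , cong proj₁ (Inverse.strictlyInverseʳ φ (u , x<u))

  -- A record rather than a product of equations, so that the flags can be inferred.
  infix 4 _≋_
  record _≋_ (Ψ Ψ′ : Flag P) : Set where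
    constructor ≋⟨_,_,_⟩
    field
      same-fv : fv Ψ ≡ fv Ψ′
      same-fe : fe Ψ ≡ fe Ψ′
      same-ff : ff Ψ ≡ ff Ψ′

  open _≋_

  ≋-refl : Ψ ≋ Ψ
  ≋-refl = ≋⟨ refl , refl , refl ⟩

  ≋-sym : Ψ ≋ Ψ′ → Ψ′ ≋ Ψ
  ≋-sym ≋⟨ v , e , f ⟩ = ≋⟨ sym v , sym e , sym f ⟩

  ≋-trans : Ψ₁ ≋ Ψ → Ψ ≋ Ψ₂ → Ψ₁ ≋ Ψ₂
  ≋-trans ≋⟨ v , e , f ⟩ ≋⟨ v′ , e′ , f′ ⟩ = ≋⟨ trans v v′ , trans e e′ , trans f f′ ⟩

  infixr 9 _⊙_
  _⊙_ : Aut P → Flag P → Flag P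
  g ⊙ Ψ = flag (app g (fv Ψ)) (app g (fe Ψ)) (app g (ff Ψ))
               (app-mono g (fv<fe Ψ)) (app-mono g (fe<ff Ψ))

  ⊙-cong : ∀ g → Ψ ≋ Ψ′ → g ⊙ Ψ ≋ g ⊙ Ψ′
  ⊙-cong g ≋⟨ v , e , f ⟩ = ≋⟨ cong (app g) v , cong (app g) e , cong (app g) f ⟩

  ⊙-injective : ∀ g → g ⊙ Ψ ≋ g ⊙ Ψ′ → Ψ ≋ Ψ′
  ⊙-injective g ≋⟨ v , e , f ⟩ = ≋⟨ app-injective g v , app-injective g e , app-injective g f ⟩

  ⊙-inverseˡ : ∀ g Ψ → invA P g ⊙ g ⊙ Ψ ≋ Ψ
  ⊙-inverseˡ g Ψ = ≋⟨ app-inverseˡ g (fv Ψ) , app-inverseˡ g (fe Ψ) , app-inverseˡ g (ff Ψ) ⟩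

  ⊙-inverseʳ : ∀ g Ψ → g ⊙ invA P g ⊙ Ψ ≋ Ψ
  ⊙-inverseʳ g Ψ = ≋⟨ app-inverseʳ g (fv Ψ) , app-inverseʳ g (fe Ψ) , app-inverseʳ g (ff Ψ) ⟩

  maps⇒≋ : ∀ g Ψ Ψ′ → _maps_to_ P g Ψ Ψ′ → g ⊙ Ψ ≋ Ψ′
  maps⇒≋ g Ψ Ψ′ (v , e , f) = ≋⟨ v , e , f ⟩

  adjacent-sym : ∀ i → IsAdjacent P i Ψ Ψ′ → IsAdjacent P i Ψ′ Ψ
  adjacent-sym zero             (v≢ , e , f) = (λ v → v≢ (sym v)) , sym e , sym f
  adjacent-sym (suc zero)       (v , e≢ , f) = sym v , (λ e → e≢ (sym e)) , sym f
  adjacent-sym (suc (suc zero)) (v , e , f≢) = sym v , sym e , λ f → f≢ (sym f)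

  adjacent-respˡ : ∀ i → Ψ ≋ Ψ′ → IsAdjacent P i Ψ Ψ₁ → IsAdjacent P i Ψ′ Ψ₁
  adjacent-respˡ zero ≋⟨ v , e , f ⟩ (v≢ , e₁ , f₁) =
    (λ v₁ → v≢ (trans v₁ (sym v))) , trans e₁ e , trans f₁ f
  adjacent-respˡ (suc zero) ≋⟨ v , e , f ⟩ (v₁ , e≢ , f₁) =
    trans v₁ v , (λ e₁ → e≢ (trans e₁ (sym e))) , trans f₁ f
  adjacent-respˡ (suc (suc zero)) ≋⟨ v , e , f ⟩ (v₁ , e₁ , f≢) =
    trans v₁ v , trans e₁ e , λ f₁ → f≢ (trans f₁ (sym f))

  ⊙-adjacent : ∀ i g → IsAdjacent P i Ψ Ψ′ → IsAdjacent P i (g ⊙ Ψ) (g ⊙ Ψ′)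
  ⊙-adjacent zero g (v≢ , e , f) =
    (λ v → v≢ (app-injective g v)) , cong (app g) e , cong (app g) f
  ⊙-adjacent (suc zero) g (v , e≢ , f) =
    cong (app g) v , (λ e → e≢ (app-injective g e)) , cong (app g) f
  ⊙-adjacent (suc (suc zero)) g (v , e , f≢) =
    cong (app g) v , cong (app g) e , λ f → f≢ (app-injective g f)

  adjacent-distinct : ∀ i → IsAdjacent P i Ψ Ψ′ → ¬ Ψ ≋ Ψ′
  adjacent-distinct zero             (v≢ , _ , _) Ψ≋Ψ′ = v≢ (sym (same-fv Ψ≋Ψ′))
  adjacent-distinct (suc zero)       (_ , e≢ , _) Ψ≋Ψ′ = e≢ (sym (same-fe Ψ≋Ψ′))
  adjacent-distinct (suc (suc zero)) (_ , _ , f≢) Ψ≋Ψ′ = f≢ (sym (same-ff Ψ≋Ψ′))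

  adjacent₁-edge-between : ∀ {Ψ Ψ′} → IsAdjacent P (suc zero) Ψ Ψ′ → fv Ψ < fe Ψ′ × fe Ψ′ < ff Ψ
  adjacent₁-edge-between {Ψ′ = Ψ′} (v , _ , f) =
    subst (_< fe Ψ′) v (fv<fe Ψ′) , subst (fe Ψ′ <_) f (fe<ff Ψ′)

  adjacent-unique : ∀ i → IsAdjacent P i Ψ Ψ₁ → IsAdjacent P i Ψ Ψ₂ → Ψ₁ ≋ Ψ₂
  adjacent-unique {Ψ} {Ψ₁} {Ψ₂} zero (v₁≢ , e₁ , f₁) (v₂≢ , e₂ , f₂) = ≋⟨
    AtMostTwo-unique (vertices-below (fv<fe Ψ) (fe<ff Ψ)) (fv<fe Ψ)
      (subst (fv Ψ₁ <_) e₁ (fv<fe Ψ₁)) (subst (fv Ψ₂ <_) e₂ (fv<fe Ψ₂)) v₁≢ v₂≢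
    , trans e₁ (sym e₂) , trans f₁ (sym f₂) ⟩
  adjacent-unique {Ψ} {Ψ₁} {Ψ₂} (suc zero) adj₁@(v₁ , e₁≢ , f₁) adj₂@(v₂ , e₂≢ , f₂) = ≋⟨
    trans v₁ (sym v₂)
    , AtMostTwo-unique (edges-between (fv<fe Ψ) (fe<ff Ψ)) (fv<fe Ψ , fe<ff Ψ)
        (adjacent₁-edge-between {Ψ} {Ψ₁} adj₁) (adjacent₁-edge-between {Ψ} {Ψ₂} adj₂) e₁≢ e₂≢
    , trans f₁ (sym f₂) ⟩
  adjacent-unique {Ψ} {Ψ₁} {Ψ₂} (suc (suc zero)) (v₁ , e₁ , f₁≢) (v₂ , e₂ , f₂≢) = ≋⟨
    trans v₁ (sym v₂) , trans e₁ (sym e₂)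
    , AtMostTwo-unique (faces-above (fv<fe Ψ) (fe<ff Ψ)) (fe<ff Ψ)
        (subst (_< ff Ψ₁) e₁ (fe<ff Ψ₁)) (subst (_< ff Ψ₂) e₂ (fe<ff Ψ₂)) f₁≢ f₂≢ ⟩

  maps-adjacent : ∀ i g → g ⊙ Ψ ≋ Ψ′ → IsAdjacent P i Ψ Ψ₁ → IsAdjacent P i Ψ′ Ψ₂ → g ⊙ Ψ₁ ≋ Ψ₂
  maps-adjacent i g gΨ≋Ψ′ adj₁ adj₂ =
    adjacent-unique i (adjacent-respˡ i gΨ≋Ψ′ (⊙-adjacent i g adj₁)) adj₂

  complete-square : ∀ {Ψ Ψ⁰ Ψ²} → IsAdjacent P zero Ψ Ψ⁰ → IsAdjacent P (suc (suc zero)) Ψ Ψ² →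
                    Σ (Flag P) λ Ω → IsAdjacent P (suc (suc zero)) Ψ⁰ Ω × IsAdjacent P zero Ψ² Ω
  complete-square {Ψ} {Ψ⁰} {Ψ²} (v⁰≢ , e⁰ , f⁰) (v² , e² , f²≢) =
    flag (fv Ψ⁰) (fe Ψ) (ff Ψ²) (subst (fv Ψ⁰ <_) e⁰ (fv<fe Ψ⁰)) (subst (_< ff Ψ²) e² (fe<ff Ψ²))
    , (refl , sym e⁰ , λ f → f²≢ (trans f f⁰))
    , ((λ v → v⁰≢ (trans v v²)) , sym e² , refl)

  agree-resp : ∀ g h → Ψ ≋ Ψ′ → g ⊙ Ψ ≋ h ⊙ Ψ → g ⊙ Ψ′ ≋ h ⊙ Ψ′
  agree-resp g h Ψ≋Ψ′ agree = ≋-trans (⊙-cong g (≋-sym Ψ≋Ψ′)) (≋-trans agree (⊙-cong h Ψ≋Ψ′))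

  agree-adjacent : ∀ i g h → IsAdjacent P i Ψ Ψ′ → g ⊙ Ψ ≋ h ⊙ Ψ → g ⊙ Ψ′ ≋ h ⊙ Ψ′
  agree-adjacent i g h adj agree = maps-adjacent i g agree adj (⊙-adjacent i h adj)

  -- Automorphisms are identified when they agree on every flag: the regularity
  -- argument cannot see elements of X that lie on no flag.
  infix 4 _∼_
  _∼_ : Aut P → Aut P → Set
  g ∼ h = ∀ Ψ → g ⊙ Ψ ≋ h ⊙ Ψ

  ≈⇒∼ : _≈_ P g h → g ∼ h
  ≈⇒∼ g≈h Ψ = ≋⟨ g≈h (fv Ψ) , g≈h (fe Ψ) , g≈h (ff Ψ) ⟩

  Γ : Group 0ℓ 0ℓ
  Γ = record
    { Carrier = Aut P
    ; _≈_     = _∼_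
    ; _∙_     = _∘A_ P
    ; ε       = idA P
    ; _⁻¹     = invA P
    ; isGroup = record
      { isMonoid = record
        { isSemigroup = record
          { isMagma = record
            { isEquivalence = record
              { refl  = λ _ → ≋-refl
              ; sym   = λ g∼h Ψ → ≋-sym (g∼h Ψ)
              ; trans = λ g∼h h∼k Ψ → ≋-trans (g∼h Ψ) (h∼k Ψ)
              }
            ; ∙-cong = λ {g} {g′} {h} g∼g′ h∼h′ Ψ → ≋-trans (g∼g′ (h ⊙ Ψ)) (⊙-cong g′ (h∼h′ Ψ))
            }
          ; assoc = λ _ _ _ _ → ≋-refl
          }
        ; identity = (λ _ _ → ≋-refl) , (λ _ _ → ≋-refl)
        }
      ; inverse = ⊙-inverseˡ , ⊙-inverseʳ
      ; ⁻¹-cong = λ {g} {h} g∼h Ψ → ⊙-injective h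
          (≋-trans (≋-sym (g∼h (invA P g ⊙ Ψ))) (≋-trans (⊙-inverseʳ g Ψ) (≋-sym (⊙-inverseʳ h Ψ))))
      }
    }

  open Subgroups Γ
  open StringCGroups Γ using (IsNonOrientableStringCGroup)

  eval-Generated : ∀ {n} (gs : Fin n → Aut P) w → Generated gs (eval P gs w)
  eval-Generated gs ε        = ε∈
  eval-Generated gs (i · w)  = gen∙ i (eval-Generated gs w)
  eval-Generated gs (i ⁻· w) = gen⁻¹∙ i (eval-Generated gs w)

  InSubgroup⇒Generated : ∀ {n} {gs : Fin n → Aut P} → InSubgroup P gs g → Generated gs g
  InSubgroup⇒Generated {g = g} {gs = gs} (w , w≈g) =
    ∈-resp (≈⇒∼ {g = eval P gs w} {h = g} w≈g) (eval-Generated gs w)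

  Generated⇒word : ∀ {n} {gs : Fin n → Aut P} → Generated gs g → Σ (Word P n) λ w → eval P gs w ∼ g
  Generated⇒word ε∈ = ε , λ _ → ≋-refl
  Generated⇒word {gs = gs} (gen∙ i g∈) =
    let w , w∼g = Generated⇒word g∈ in i · w , λ Ψ → ⊙-cong (gs i) (w∼g Ψ)
  Generated⇒word {gs = gs} (gen⁻¹∙ i g∈) =
    let w , w∼g = Generated⇒word g∈ in i ⁻· w , λ Ψ → ⊙-cong (invA P (gs i)) (w∼g Ψ)
  Generated⇒word (∈-resp g∼h g∈) =
    let w , w∼g = Generated⇒word g∈ in w , λ Ψ → ≋-trans (w∼g Ψ) (g∼h Ψ)

  IsNormal⇒Normal : ∀ {n} {gs : Fin n → Aut P} → IsNormal P gs → Normal (Generated gs)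
  IsNormal⇒Normal {gs = gs} gs-normal g h∈ =
    let w , w∼h = Generated⇒word h∈
    in ∈-resp {g = _∘A_ P (_∘A_ P g (eval P gs w)) (invA P g)} (λ Ψ → ⊙-cong g (w∼h (invA P g ⊙ Ψ)))
         (InSubgroup⇒Generated (gs-normal g (eval P gs w) (w , λ _ → refl)))

  Fixes : X → Aut P → Set
  Fixes x g = app g x ≡ x

  Fixes-isSubgroup : ∀ x → (∀ {g h} → g ∼ h → app g x ≡ app h x) → IsSubgroup (Fixes x)
  Fixes-isSubgroup x agree-at-x = record
    { resp      = λ {g} {h} g∼h gx≡x → trans (sym (agree-at-x {g} {h} g∼h)) gx≡x
    ; ε-closed  = refl
    ; ∙-closed  = λ {g} gx≡x hx≡x → trans (cong (app g) hx≡x) gx≡x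
    ; ⁻¹-closed = λ {g} gx≡x → trans (cong (app (invA P g)) (sym gx≡x)) (app-inverseˡ g x)
    }

  module BaseFlag (Φ : Flag P) (ρ₀ ρ₁ ρ₂ : Aut P) {Φ⁰ Φ¹ Φ² : Flag P}
    (Φ~Φ⁰ : IsAdjacent P zero Φ Φ⁰) (ρ₀Φ≋Φ⁰ : ρ₀ ⊙ Φ ≋ Φ⁰)
    (Φ~Φ¹ : IsAdjacent P (suc zero) Φ Φ¹) (ρ₁Φ≋Φ¹ : ρ₁ ⊙ Φ ≋ Φ¹)
    (Φ~Φ² : IsAdjacent P (suc (suc zero)) Φ Φ²) (ρ₂Φ≋Φ² : ρ₂ ⊙ Φ ≋ Φ²)
    (regular : IsRegular P)
    (rotations-generate : ∀ g → InSubgroup P (two P (_∘A_ P ρ₀ ρ₁) (_∘A_ P ρ₁ ρ₂)) g)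
    where

    private
      rotations : Fin 2 → Aut P
      rotations = two P (_∘A_ P ρ₀ ρ₁) (_∘A_ P ρ₁ ρ₂)

    record Agrees (g h k : Aut P) : Set where
      constructor agrees
      field on-image : g ⊙ k ⊙ Φ ≋ h ⊙ k ⊙ Φ

    agrees-∘ρ : ∀ i ρ → IsAdjacent P i Φ Ψ → ρ ⊙ Φ ≋ Ψ → Agrees g h k → Agrees g h (_∘A_ P k ρ)
    agrees-∘ρ {g = g} {h = h} {k = k} i ρ adj ρΦ≋Ψ (agrees agree) =
      agrees (agree-resp g h (≋-sym (⊙-cong k ρΦ≋Ψ))
                (agree-adjacent i g h (⊙-adjacent i k adj) agree))

    agrees-∘ρ⁻¹ : ∀ i ρ → IsAdjacent P i Φ Ψ → ρ ⊙ Φ ≋ Ψ → Agrees g h (_∘A_ P k ρ) → Agrees g h k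
    agrees-∘ρ⁻¹ {g = g} {h = h} {k = k} i ρ adj ρΦ≋Ψ (agrees agree) =
      agrees (agree-adjacent i g h (⊙-adjacent i k (adjacent-sym i adj))
                (agree-resp g h (⊙-cong k ρΦ≋Ψ) agree))

    agrees-∘rotation : ∀ i → Agrees g h k → Agrees g h (_∘A_ P k (rotations i))
    agrees-∘rotation zero    =
      agrees-∘ρ (suc zero) ρ₁ Φ~Φ¹ ρ₁Φ≋Φ¹ ∘′ agrees-∘ρ zero ρ₀ Φ~Φ⁰ ρ₀Φ≋Φ⁰
    agrees-∘rotation (suc _) =
      agrees-∘ρ (suc (suc zero)) ρ₂ Φ~Φ² ρ₂Φ≋Φ² ∘′ agrees-∘ρ (suc zero) ρ₁ Φ~Φ¹ ρ₁Φ≋Φ¹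

    agrees-∘rotation⁻¹ : ∀ i → Agrees g h k → Agrees g h (_∘A_ P k (invA P (rotations i)))
    agrees-∘rotation⁻¹ {g} {h} {k} i (agrees agree) =
      undo i (agrees (agree-resp g h (≋-sym (⊙-cong k (⊙-inverseˡ (rotations i) Φ))) agree))
      where
      undo : ∀ i → Agrees g h (_∘A_ P (_∘A_ P k (invA P (rotations i))) (rotations i)) →
             Agrees g h (_∘A_ P k (invA P (rotations i)))
      undo zero    =
        agrees-∘ρ⁻¹ zero ρ₀ Φ~Φ⁰ ρ₀Φ≋Φ⁰ ∘′ agrees-∘ρ⁻¹ (suc zero) ρ₁ Φ~Φ¹ ρ₁Φ≋Φ¹
      undo (suc _) =
        agrees-∘ρ⁻¹ (suc zero) ρ₁ Φ~Φ¹ ρ₁Φ≋Φ¹ ∘′ agrees-∘ρ⁻¹ (suc (suc zero)) ρ₂ Φ~Φ² ρ₂Φ≋Φ²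

    agrees-∘word : ∀ w → Agrees g h k → Agrees g h (_∘A_ P k (eval P rotations w))
    agrees-∘word ε        (agrees agree) = agrees agree
    agrees-∘word (i · w)  = agrees-∘word w ∘′ agrees-∘rotation i
    agrees-∘word (i ⁻· w) = agrees-∘word w ∘′ agrees-∘rotation⁻¹ i

    determined : g ⊙ Φ ≋ h ⊙ Φ → g ∼ h
    determined {g} {h} agree Ψ =
      let k , k↦Ψ = regular Φ Ψ
          w , w≈k = rotations-generate k
          agrees on-wΦ = agrees-∘word {g} {h} {idA P} w (agrees agree)
      in agree-resp g h
           (≋-trans (≈⇒∼ {g = eval P rotations w} {h = k} w≈k Φ) (maps⇒≋ k Φ Ψ k↦Ψ)) on-wΦ

    involutive : ∀ i ρ → IsAdjacent P i Φ Ψ → ρ ⊙ Φ ≋ Ψ → _∘A_ P ρ ρ ∼ idA P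
    involutive i ρ adj ρΦ≋Ψ = determined {_∘A_ P ρ ρ} {idA P}
      (≋-trans (⊙-cong ρ ρΦ≋Ψ) (maps-adjacent i ρ ρΦ≋Ψ adj (adjacent-sym i adj)))

    nontrivial : ∀ i ρ → IsAdjacent P i Φ Ψ → ρ ⊙ Φ ≋ Ψ → ¬ ρ ∼ idA P
    nontrivial i ρ adj ρΦ≋Ψ ρ∼id = adjacent-distinct i adj (≋-trans (≋-sym (ρ∼id Φ)) ρΦ≋Ψ)

    ρ₀ρ₂-commute : _∘A_ P ρ₀ ρ₂ ∼ _∘A_ P ρ₂ ρ₀
    ρ₀ρ₂-commute = determined {_∘A_ P ρ₀ ρ₂} {_∘A_ P ρ₂ ρ₀} (≋-trans ρ₀ρ₂Φ≋Ω (≋-sym ρ₂ρ₀Φ≋Ω))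
      where
      square : Σ (Flag P) λ Ω → IsAdjacent P (suc (suc zero)) Φ⁰ Ω × IsAdjacent P zero Φ² Ω
      square = complete-square {Φ} {Φ⁰} {Φ²} Φ~Φ⁰ Φ~Φ²
      Ω : Flag P
      Ω = proj₁ square
      ρ₀ρ₂Φ≋Ω : ρ₀ ⊙ ρ₂ ⊙ Φ ≋ Ω
      ρ₀ρ₂Φ≋Ω = ≋-trans (⊙-cong ρ₀ ρ₂Φ≋Φ²)
        (maps-adjacent (suc (suc zero)) ρ₀ ρ₀Φ≋Φ⁰ Φ~Φ² (proj₁ (proj₂ square)))
      ρ₂ρ₀Φ≋Ω : ρ₂ ⊙ ρ₀ ⊙ Φ ≋ Ω
      ρ₂ρ₀Φ≋Ω = ≋-trans (⊙-cong ρ₂ ρ₀Φ≋Φ⁰)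
        (maps-adjacent zero ρ₂ ρ₂Φ≋Φ² Φ~Φ⁰ (proj₂ (proj₂ square)))

    vertex-face-stabiliser : Fixes (fv Φ) g → Fixes (ff Φ) g → g ∼ idA P ⊎ g ∼ ρ₁
    vertex-face-stabiliser {g} gv≡v gF≡F =
      identify (AtMostTwo-other (edges-between (fv<fe Φ) (fe<ff Φ)) (fv<fe Φ , fe<ff Φ)
                  (adjacent₁-edge-between {Φ} {Φ¹} Φ~Φ¹) (proj₁ (proj₂ Φ~Φ¹)) ge-between)
      where
      ge-between : fv Φ < app g (fe Φ) × app g (fe Φ) < ff Φ
      ge-between = subst (_< app g (fe Φ)) gv≡v (app-mono g (fv<fe Φ))
                 , subst (app g (fe Φ) <_) gF≡F (app-mono g (fe<ff Φ))
      identify : app g (fe Φ) ≡ fe Φ ⊎ app g (fe Φ) ≡ fe Φ¹ → g ∼ idA P ⊎ g ∼ ρ₁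
      identify (inj₁ ge≡e)  = inj₁ (determined {g} {idA P} ≋⟨ gv≡v , ge≡e , gF≡F ⟩)
      identify (inj₂ ge≡e¹) = inj₂ (determined {g} {ρ₁} (≋-trans gΦ≋Φ¹ (≋-sym ρ₁Φ≋Φ¹)))
        where
        gΦ≋Φ¹ : g ⊙ Φ ≋ Φ¹
        gΦ≋Φ¹ = ≋⟨ trans gv≡v (sym (proj₁ Φ~Φ¹)) , ge≡e¹ , trans gF≡F (sym (proj₂ (proj₂ Φ~Φ¹))) ⟩

    ⟨ρ₀,ρ₁⟩⊆Fixes-ff : ⟨ ρ₀ , ρ₁ ⟩ ⊆ Fixes (ff Φ)
    ⟨ρ₀,ρ₁⟩⊆Fixes-ff = Generated-minimal (Fixes-isSubgroup (ff Φ) (λ g∼h → same-ff (g∼h Φ))) fixes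
      where
      fixes : ∀ i → Fixes (ff Φ) (pair ρ₀ ρ₁ i)
      fixes zero    = trans (same-ff ρ₀Φ≋Φ⁰) (proj₂ (proj₂ Φ~Φ⁰))
      fixes (suc _) = trans (same-ff ρ₁Φ≋Φ¹) (proj₂ (proj₂ Φ~Φ¹))

    ⟨ρ₁,ρ₂⟩⊆Fixes-fv : ⟨ ρ₁ , ρ₂ ⟩ ⊆ Fixes (fv Φ)
    ⟨ρ₁,ρ₂⟩⊆Fixes-fv = Generated-minimal (Fixes-isSubgroup (fv Φ) (λ g∼h → same-fv (g∼h Φ))) fixes
      where
      fixes : ∀ i → Fixes (fv Φ) (pair ρ₁ ρ₂ i)
      fixes zero    = trans (same-fv ρ₁Φ≋Φ¹) (proj₁ Φ~Φ¹)
      fixes (suc _) = trans (same-fv ρ₂Φ≋Φ²) (proj₁ Φ~Φ²)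

    isNonOrientableStringCGroup : IsNonOrientableStringCGroup ρ₀ ρ₁ ρ₂
    isNonOrientableStringCGroup = record
      { involutive₀  = involutive zero ρ₀ Φ~Φ⁰ ρ₀Φ≋Φ⁰
      ; involutive₁  = involutive (suc zero) ρ₁ Φ~Φ¹ ρ₁Φ≋Φ¹
      ; involutive₂  = involutive (suc (suc zero)) ρ₂ Φ~Φ² ρ₂Φ≋Φ²
      ; nontrivial₀  = nontrivial zero ρ₀ Φ~Φ⁰ ρ₀Φ≋Φ⁰
      ; nontrivial₁  = nontrivial (suc zero) ρ₁ Φ~Φ¹ ρ₁Φ≋Φ¹
      ; nontrivial₂  = nontrivial (suc (suc zero)) ρ₂ Φ~Φ² ρ₂Φ≋Φ²
      ; commute₀₂    = ρ₀ρ₂-commute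
      ; intersection = λ {g} g∈⟨ρ₀,ρ₁⟩ g∈⟨ρ₁,ρ₂⟩ →
          vertex-face-stabiliser {g} (⟨ρ₁,ρ₂⟩⊆Fixes-fv g∈⟨ρ₁,ρ₂⟩) (⟨ρ₀,ρ₁⟩⊆Fixes-ff g∈⟨ρ₀,ρ₁⟩)
      ; rotations-generate = λ g → Generated-mono rotation∈ (InSubgroup⇒Generated (rotations-generate g))
      }
      where
      rotation∈ : ∀ i → ⟨ _∘A_ P ρ₀ ρ₁ , _∘A_ P ρ₁ ρ₂ ⟩ (rotations i)
      rotation∈ zero    = gen∈ zero
      rotation∈ (suc _) = gen∈ (suc zero)

proposition5p1 : (P : Polyhedron) (p q : ℕ) → HasType P p q →
    (Φ : Flag P) (ρ₀ ρ₁ ρ₂ : Aut P) →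
    MapsToAdjacent P zero ρ₀ Φ →
    MapsToAdjacent P (suc zero) ρ₁ Φ →
    MapsToAdjacent P (suc (suc zero)) ρ₂ Φ →
    IsNonOrientablyRegular P (_∘A_ P ρ₀ ρ₁) (_∘A_ P ρ₁ ρ₂) →
    ¬ IsNormal P (one P (_∘A_ P (_∘A_ P ρ₀ ρ₁) (_∘A_ P ρ₀ ρ₁)))
      × ¬ IsNormal P (one P (_∘A_ P (_∘A_ P ρ₁ ρ₂) (_∘A_ P ρ₁ ρ₂)))
proposition5p1 P _ _ _ Φ ρ₀ ρ₁ ρ₂ (Φ⁰ , Φ~Φ⁰ , ρ₀↦Φ⁰) (Φ¹ , Φ~Φ¹ , ρ₁↦Φ¹) (Φ² , Φ~Φ² , ρ₂↦Φ²)
             (regular , rotations-generate) =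
  (λ σ₁²-normal → σ₁²-not-normal 𝒢 (IsNormal⇒Normal σ₁²-normal)) ,
  (λ σ₂²-normal → σ₂²-not-normal 𝒢 (IsNormal⇒Normal σ₂²-normal))
  where
  open Polyhedral P
  open StringCGroups Γ using (IsNonOrientableStringCGroup; σ₁²-not-normal; σ₂²-not-normal)
  𝒢 : IsNonOrientableStringCGroup ρ₀ ρ₁ ρ₂
  𝒢 = BaseFlag.isNonOrientableStringCGroup Φ ρ₀ ρ₁ ρ₂
        Φ~Φ⁰ (maps⇒≋ ρ₀ Φ Φ⁰ ρ₀↦Φ⁰) Φ~Φ¹ (maps⇒≋ ρ₁ Φ Φ¹ ρ₁↦Φ¹) Φ~Φ² (maps⇒≋ ρ₂ Φ Φ² ρ₂↦Φ²)
        regular rotations-generate
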